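{- Let $\mathcal{C}$ be a full comprehension category equipped with pseudo-stable dependent products. Then $\mathcal{C}$ carries a stable class of dependent products, consisting of all dependent products $(\Pi,\mathrm{app})$ equipped with isomorphisms to those supplied by the pseudo-stable structure (compatible with the application maps), and all $\lambda$-abstractions corresponding under those isomorphisms to the ones provided by the pseudo-stable structure.
   Context: A full comprehension category $\mathcal{C}=(\mathcal{C},\mathcal{T},p,\chi)$: a category $\mathcal{C}$, a cloven Grothendieck fibration $p:\mathcal{T}\to\mathcal{C}$, a fully faithful functor $\chi:\mathcal{T}\to\mathcal{C}^{\to}$ with $\mathrm{cod}\circ\chi=p$ sending cartesian arrows to pullback squares. For $A\in\mathcal{T}(\Gamma)$, $\chi(A):\Gamma.A\to\Gamma$; for $\sigma:\Delta\to\Gamma$, $A[\sigma]$ is a reindexing and $f[\sigma]$ the induced reindexing of a map in a fibre. A section of $A$ is a section of $\chi(A)$. For a map $\sigma_A$ in $\mathcal{T}$ over $\sigma$, write $\sigma.\sigma_A:=\chi(\sigma_A)$. Dependent product for $A\in\mathcal{T}(\Gamma)$, $B\in\mathcal{T}(\Gamma.A)$: $\Pi[A,B]\in\mathcal{T}(\Gamma)$, $\mathrm{app}_{A,B}:\Pi[A,B][\chi(A)]\to B$ in $\mathcal{T}(\Gamma.A)$, and for each section $t$ of $B$ a section $\lambda(t)$ of $\Pi[A,B]$ with $(\Gamma.A.\mathrm{app}_{A,B})\circ(1,\lambda(t))=t$. Pseudo-stable dependent products: operations giving a dependent product $(\Pi[A,B],\mathrm{app}_{A,B},\lambda_{A,B})$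 for every $\Gamma,A,B$, together with, for each $\sigma:\Gamma'\to\Gamma$, cartesian $\sigma_A:A'\to A$ over $\sigma$ and cartesian $\sigma_B:B'\to B$ over $\sigma.\sigma_A$, a cartesian map $\Pi[\sigma_A,\sigma_B]:\Pi[A',B']\to\Pi[A,B]$ over $\sigma$, such that $\Pi[1_A,1_B]=1$, $\Pi[\tau_A\circ\sigma_A,\tau_B\circ\sigma_B]=\Pi[\tau_A,\tau_B]\circ\Pi[\sigma_A,\sigma_B]$, $\sigma.\sigma_B\circ\mathrm{app}_{A',B'}=\mathrm{app}_{A,B}\circ\sigma.\sigma_A.\Pi[\sigma_A,\sigma_B]$, and $\sigma.\Pi[\sigma_A,\sigma_B]\circ\lambda_{A',B'}(t[\sigma])=\lambda_{A,B}(t)\circ\sigma$ for all suitable data. A stable class of dependent products: for each $\Gamma,A,B$ a nonempty family of pairs $(\Pi,\mathrm{app})$ that are dependent products for $A,B$ (good), and for each good $(\Pi,\mathrm{app})$ and section $t$ a nonempty family of sections $\lambda(t)$ satisfying the dependent product equation (good $\lambda$-abstractions), both families closed under arbitrary reindexing along any map. -}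

module Defs where

open import Level using (Level; _⊔_) renaming (suc to lsuc)
open import Relation.Binary.PropositionalEquality using (_≡_; subst; sym)
open import Data.Product using (Σ; _×_; _,_; proj₁; proj₂)

record Category (o h : Level) : Set (lsuc (o ⊔ h)) where
  infixr 9 _∘_
  field
    Obj   : Set o
    Hom   : Obj → Obj → Set h
    id    : ∀ {X} → Hom X X
    _∘_   : ∀ {X Y Z} → Hom Y Z → Hom X Y → Hom X Z
    idˡ   : ∀ {X Y} (f : Hom X Y) → id ∘ f ≡ f
    idʳ   : ∀ {X Y} (f : Hom X Y) → f ∘ id ≡ f
    assoc : ∀ {W X Y Z} (k : Hom Y Z) (g : Hom X Y) (f : Hom W X) →
            (k ∘ g) ∘ f ≡ k ∘ (g ∘ f)

  IsPullback : ∀ {P X Y Z} → Hom X Z → Hom Y Z → Hom P X → Hom P Y → Set (o ⊔ h)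
  IsPullback {P} {X} {Y} f g p₁ p₂ =
    (f ∘ p₁ ≡ g ∘ p₂) ×
    (∀ {Q} (q₁ : Hom Q X) (q₂ : Hom Q Y) → f ∘ q₁ ≡ g ∘ q₂ →
       Σ (Hom Q P) λ v → (p₁ ∘ v ≡ q₁) × (p₂ ∘ v ≡ q₂) ×
         (∀ (w : Hom Q P) → p₁ ∘ w ≡ q₁ → p₂ ∘ w ≡ q₂ → w ≡ v))

-- A functor p : 𝒯 → 𝒞, presented as a displayed category over 𝒞:
-- Ty Γ = objects of 𝒯 over Γ, TyHom σ A B = maps of 𝒯 from A to B over σ.

record Displayed {o h} (C : Category o h) (t u : Level) : Set (o ⊔ h ⊔ lsuc (t ⊔ u)) where
  open Category C
  infixr 9 _∘ᵈ_
  field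
    Ty     : Obj → Set t
    TyHom  : ∀ {Δ Γ} → Hom Δ Γ → Ty Δ → Ty Γ → Set u
    idᵈ    : ∀ {Γ} {A : Ty Γ} → TyHom id A A
    _∘ᵈ_   : ∀ {Θ Δ Γ} {τ : Hom Δ Γ} {σ : Hom Θ Δ} {A : Ty Θ} {B : Ty Δ} {D : Ty Γ} →
             TyHom τ B D → TyHom σ A B → TyHom (τ ∘ σ) A D
    idˡᵈ   : ∀ {Δ Γ} {σ : Hom Δ Γ} {A : Ty Δ} {B : Ty Γ} (f : TyHom σ A B) →
             subst (λ s → TyHom s A B) (idˡ σ) (idᵈ ∘ᵈ f) ≡ f
    idʳᵈ   : ∀ {Δ Γ} {σ : Hom Δ Γ} {A : Ty Δ} {B : Ty Γ} (f : TyHom σ A B) →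
             subst (λ s → TyHom s A B) (idʳ σ) (f ∘ᵈ idᵈ) ≡ f
    assocᵈ : ∀ {Ξ Θ Δ Γ} {ρ : Hom Δ Γ} {τ : Hom Θ Δ} {σ : Hom Ξ Θ}
               {A : Ty Ξ} {B : Ty Θ} {D : Ty Δ} {E : Ty Γ}
               (k : TyHom ρ D E) (g : TyHom τ B D) (f : TyHom σ A B) →
             subst (λ s → TyHom s A E) (assoc ρ τ σ) ((k ∘ᵈ g) ∘ᵈ f) ≡ k ∘ᵈ (g ∘ᵈ f)

module _ {o h t u} {C : Category o h} (T : Displayed C t u) where
  open Category C
  open Displayed T

  IsCartesian : ∀ {Δ Γ} {σ : Hom Δ Γ} {A' : Ty Δ} {A : Ty Γ} →
                TyHom σ A' A → Set (o ⊔ h ⊔ t ⊔ u)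
  IsCartesian {Δ} {Γ} {σ} {A'} {A} f =
    ∀ {Θ} {τ : Hom Θ Δ} {X : Ty Θ} (g : TyHom (σ ∘ τ) X A) →
      Σ (TyHom τ X A') λ k → (f ∘ᵈ k ≡ g) ×
        (∀ (k' : TyHom τ X A') → f ∘ᵈ k' ≡ g → k' ≡ k)

record FullComprehensionCategory (o h t u : Level) : Set (lsuc (o ⊔ h ⊔ t ⊔ u)) where
  field
    C : Category o h
    T : Displayed C t u
  open Category C public
  open Displayed T public
  infixl 20 _⟨_⟩
  field
    _⟨_⟩      : ∀ {Δ Γ} → Ty Γ → Hom Δ Γ → Ty Δ
    lift      : ∀ {Δ Γ} (A : Ty Γ) (σ : Hom Δ Γ) → TyHom σ (A ⟨ σ ⟩) A
    lift-cart : ∀ {Δ Γ} (A : Ty Γ) (σ : Hom Δ Γ) → IsCartesian T (lift A σ)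
    -- χ : 𝒯 → 𝒞^→ with cod ∘ χ = p;  χ(A) = prj A : ctx A → Γ  (ctx A = Γ.A)
    ctx       : ∀ {Γ} → Ty Γ → Obj
    prj       : ∀ {Γ} (A : Ty Γ) → Hom (ctx A) Γ
    χ         : ∀ {Δ Γ} {σ : Hom Δ Γ} {A : Ty Δ} {B : Ty Γ} → TyHom σ A B → Hom (ctx A) (ctx B)
    χ-sq      : ∀ {Δ Γ} {σ : Hom Δ Γ} {A : Ty Δ} {B : Ty Γ} (f : TyHom σ A B) →
                prj B ∘ χ f ≡ σ ∘ prj A
    χ-id      : ∀ {Γ} {A : Ty Γ} → χ (idᵈ {A = A}) ≡ id
    χ-∘       : ∀ {Θ Δ Γ} {τ : Hom Δ Γ} {σ : Hom Θ Δ} {A : Ty Θ} {B : Ty Δ} {D : Ty Γ}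
                (g : TyHom τ B D) (f : TyHom σ A B) → χ (g ∘ᵈ f) ≡ χ g ∘ χ f
    χ-full    : ∀ {Δ Γ} {σ : Hom Δ Γ} {A : Ty Δ} {B : Ty Γ} (k : Hom (ctx A) (ctx B)) →
                prj B ∘ k ≡ σ ∘ prj A → Σ (TyHom σ A B) λ f → χ f ≡ k
    χ-faithful : ∀ {Δ Γ} {σ : Hom Δ Γ} {A : Ty Δ} {B : Ty Γ} (f g : TyHom σ A B) →
                 χ f ≡ χ g → f ≡ g
    χ-cart    : ∀ {Δ Γ} {σ : Hom Δ Γ} {A : Ty Δ} {B : Ty Γ} (f : TyHom σ A B) →
                IsCartesian T f → IsPullback (prj B) σ (χ f) (prj A)

module _ {o h t u} (F : FullComprehensionCategory o h t u) where
  open FullComprehensionCategory F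

  Section : ∀ {Γ} → Ty Γ → Set h
  Section {Γ} A = Σ (Hom Γ (ctx A)) λ s → prj A ∘ s ≡ id

  -- the dependent-product equation  (Γ.A.app) ∘ (1 , λ(t)) = t,
  -- where (1 , λ(t)) : Γ.A → Γ.A.Π[χ(A)] is the map into the pullback
  -- (characterised by its two components)
  DPEq : ∀ {Γ} {A : Ty Γ} {B : Ty (ctx A)} (Π : Ty Γ) →
         TyHom id (Π ⟨ prj A ⟩) B → Section B → Section Π → Set h
  DPEq {Γ} {A} {B} Π app t l =
    ∀ (v : Hom (ctx A) (ctx (Π ⟨ prj A ⟩))) →
      prj (Π ⟨ prj A ⟩) ∘ v ≡ id →
      χ (lift Π (prj A)) ∘ v ≡ proj₁ l ∘ prj A →
      χ app ∘ v ≡ proj₁ t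

  idOver : ∀ {Γ} {A : Ty Γ} (B : Ty (ctx A)) → TyHom (χ (idᵈ {A = A})) B B
  idOver B = subst (λ s → TyHom s B B) (sym χ-id) idᵈ

  compOver : ∀ {Γ'' Γ' Γ} {σ : Hom Γ'' Γ'} {τ : Hom Γ' Γ}
               {A'' : Ty Γ''} {A' : Ty Γ'} {A : Ty Γ}
               {B'' : Ty (ctx A'')} {B' : Ty (ctx A')} {B : Ty (ctx A)}
               (σA : TyHom σ A'' A') (τA : TyHom τ A' A) →
             TyHom (χ τA) B' B → TyHom (χ σA) B'' B' → TyHom (χ (τA ∘ᵈ σA)) B'' B
  compOver {B'' = B''} {B = B} σA τA τB σB =
    subst (λ s → TyHom s B'' B) (sym (χ-∘ τA σA)) (τB ∘ᵈ σB)

  -- compatibility of application maps along σ.σ_A :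
  --   σ.σ_B ∘ app' = app ∘ σ.σ_A.φ ,
  -- where σ.σ_A.φ : Γ'.A'.Π'[χ(A')] → Γ.A.Π[χ(A)] is χ of the map over σ.σ_A
  -- induced by φ (characterised by its two components into the pullback)
  AppCompat : ∀ {Γ' Γ} {σ : Hom Γ' Γ} {A' : Ty Γ'} {A : Ty Γ}
                {B' : Ty (ctx A')} {B : Ty (ctx A)} {Π' : Ty Γ'} {Π : Ty Γ}
                (σA : TyHom σ A' A) (σB : TyHom (χ σA) B' B) (φ : TyHom σ Π' Π) →
              TyHom id (Π' ⟨ prj A' ⟩) B' → TyHom id (Π ⟨ prj A ⟩) B → Set h
  AppCompat {A' = A'} {A} {Π' = Π'} {Π} σA σB φ app' app =
    ∀ (m : Hom (ctx (Π' ⟨ prj A' ⟩)) (ctx (Π ⟨ prj A ⟩))) →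
      prj (Π ⟨ prj A ⟩) ∘ m ≡ χ σA ∘ prj (Π' ⟨ prj A' ⟩) →
      χ (lift Π (prj A)) ∘ m ≡ χ φ ∘ χ (lift Π' (prj A')) →
      χ σB ∘ χ app' ≡ χ app ∘ m

  record PseudoStablePi : Set (o ⊔ h ⊔ t ⊔ u) where
    field
      Π      : ∀ {Γ} (A : Ty Γ) (B : Ty (ctx A)) → Ty Γ
      app    : ∀ {Γ} (A : Ty Γ) (B : Ty (ctx A)) → TyHom id (Π A B ⟨ prj A ⟩) B
      lam    : ∀ {Γ} (A : Ty Γ) (B : Ty (ctx A)) → Section B → Section (Π A B)
      lam-eq : ∀ {Γ} (A : Ty Γ) (B : Ty (ctx A)) (t : Section B) →
               DPEq (Π A B) (app A B) t (lam A B t)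
      Πmap   : ∀ {Γ' Γ} {σ : Hom Γ' Γ} {A' : Ty Γ'} {A : Ty Γ}
                 {B' : Ty (ctx A')} {B : Ty (ctx A)}
                 (σA : TyHom σ A' A) (σB : TyHom (χ σA) B' B) →
               IsCartesian T σA → IsCartesian T σB → TyHom σ (Π A' B') (Π A B)
      Πmap-cart : ∀ {Γ' Γ} {σ : Hom Γ' Γ} {A' : Ty Γ'} {A : Ty Γ}
                    {B' : Ty (ctx A')} {B : Ty (ctx A)}
                    (σA : TyHom σ A' A) (σB : TyHom (χ σA) B' B)
                    (cA : IsCartesian T σA) (cB : IsCartesian T σB) →
                  IsCartesian T (Πmap σA σB cA cB)
      Πmap-id : ∀ {Γ} {A : Ty Γ} {B : Ty (ctx A)}
                  (cA : IsCartesian T (idᵈ {A = A})) (cB : IsCartesian T (idOver B)) →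
                Πmap idᵈ (idOver B) cA cB ≡ idᵈ
      Πmap-∘  : ∀ {Γ'' Γ' Γ} {σ : Hom Γ'' Γ'} {τ : Hom Γ' Γ}
                  {A'' : Ty Γ''} {A' : Ty Γ'} {A : Ty Γ}
                  {B'' : Ty (ctx A'')} {B' : Ty (ctx A')} {B : Ty (ctx A)}
                  (σA : TyHom σ A'' A') (σB : TyHom (χ σA) B'' B')
                  (τA : TyHom τ A' A) (τB : TyHom (χ τA) B' B)
                  (cσA : IsCartesian T σA) (cσB : IsCartesian T σB)
                  (cτA : IsCartesian T τA) (cτB : IsCartesian T τB)
                  (c₁ : IsCartesian T (τA ∘ᵈ σA)) (c₂ : IsCartesian T (compOver σA τA τB σB)) →
                Πmap (τA ∘ᵈ σA) (compOver σA τA τB σB) c₁ c₂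
                  ≡ Πmap τA τB cτA cτB ∘ᵈ Πmap σA σB cσA cσB
      Πmap-app : ∀ {Γ' Γ} {σ : Hom Γ' Γ} {A' : Ty Γ'} {A : Ty Γ}
                   {B' : Ty (ctx A')} {B : Ty (ctx A)}
                   (σA : TyHom σ A' A) (σB : TyHom (χ σA) B' B)
                   (cA : IsCartesian T σA) (cB : IsCartesian T σB) →
                 AppCompat σA σB (Πmap σA σB cA cB) (app A' B') (app A B)
      -- σ.Π[σ_A,σ_B] ∘ λ(t[σ]) = λ(t) ∘ σ, with t[σ] characterised by
      -- χ(σ_B) ∘ t[σ] = t ∘ χ(σ_A) (unique since χ(σ_B) is a pullback)
      Πmap-lam : ∀ {Γ' Γ} {σ : Hom Γ' Γ} {A' : Ty Γ'} {A : Ty Γ}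
                   {B' : Ty (ctx A')} {B : Ty (ctx A)}
                   (σA : TyHom σ A' A) (σB : TyHom (χ σA) B' B)
                   (cA : IsCartesian T σA) (cB : IsCartesian T σB)
                   (tm : Section B) (tm' : Section B') →
                 χ σB ∘ proj₁ tm' ≡ proj₁ tm ∘ χ σA →
                 χ (Πmap σA σB cA cB) ∘ proj₁ (lam A' B' tm') ≡ proj₁ (lam A B tm) ∘ σ

  record IsStableClass {ℓ ℓ'}
    (Good : ∀ {Γ} {A : Ty Γ} {B : Ty (ctx A)} (Π : Ty Γ) → TyHom id (Π ⟨ prj A ⟩) B → Set ℓ)
    (GoodLam : ∀ {Γ} {A : Ty Γ} {B : Ty (ctx A)} (Π : Ty Γ) → TyHom id (Π ⟨ prj A ⟩) B →
               Section B → Section Π → Set ℓ')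
    : Set (o ⊔ h ⊔ t ⊔ u ⊔ ℓ ⊔ ℓ') where
    field
      good-nonempty : ∀ {Γ} (A : Ty Γ) (B : Ty (ctx A)) →
                      Σ (Ty Γ) λ Π → Σ (TyHom id (Π ⟨ prj A ⟩) B) λ ap → Good Π ap
      lam-nonempty  : ∀ {Γ} {A : Ty Γ} {B : Ty (ctx A)} (Π : Ty Γ) (ap : TyHom id (Π ⟨ prj A ⟩) B) →
                      Good Π ap → (tm : Section B) → Σ (Section Π) λ l → GoodLam Π ap tm l
      lam-eq        : ∀ {Γ} {A : Ty Γ} {B : Ty (ctx A)} (Π : Ty Γ) (ap : TyHom id (Π ⟨ prj A ⟩) B) →
                      Good Π ap → (tm : Section B) (l : Section Π) → GoodLam Π ap tm l →
                      DPEq Π ap tm l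
      good-reindex  : ∀ {Γ' Γ} {σ : Hom Γ' Γ} {A' : Ty Γ'} {A : Ty Γ}
                        {B' : Ty (ctx A')} {B : Ty (ctx A)}
                        (σA : TyHom σ A' A) (σB : TyHom (χ σA) B' B) →
                      IsCartesian T σA → IsCartesian T σB →
                      (Π : Ty Γ) (ap : TyHom id (Π ⟨ prj A ⟩) B) → Good Π ap →
                      (Π' : Ty Γ') (φ : TyHom σ Π' Π) → IsCartesian T φ →
                      (ap' : TyHom id (Π' ⟨ prj A' ⟩) B') → AppCompat σA σB φ ap' ap →
                      Good Π' ap'
      lam-reindex   : ∀ {Γ' Γ} {σ : Hom Γ' Γ} {A' : Ty Γ'} {A : Ty Γ}
                        {B' : Ty (ctx A')} {B : Ty (ctx A)}
                        (σA : TyHom σ A' A) (σB : TyHom (χ σA) B' B) →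
                      IsCartesian T σA → IsCartesian T σB →
                      (Π : Ty Γ) (ap : TyHom id (Π ⟨ prj A ⟩) B) → Good Π ap →
                      (Π' : Ty Γ') (φ : TyHom σ Π' Π) → IsCartesian T φ →
                      (ap' : TyHom id (Π' ⟨ prj A' ⟩) B') → AppCompat σA σB φ ap' ap →
                      (tm : Section B) (l : Section Π) → GoodLam Π ap tm l →
                      (tm' : Section B') → χ σB ∘ proj₁ tm' ≡ proj₁ tm ∘ χ σA →
                      (l' : Section Π') → χ φ ∘ proj₁ l' ≡ proj₁ l ∘ σ →
                      GoodLam Π' ap' tm' l'

  IsVerticalIso : ∀ {Γ} {X Y : Ty Γ} → TyHom id X Y → Set u
  IsVerticalIso {Γ} {X} {Y} θ =
    Σ (TyHom id Y X) λ θ⁻ →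
      (subst (λ s → TyHom s Y Y) (idˡ id) (θ ∘ᵈ θ⁻) ≡ idᵈ) ×
      (subst (λ s → TyHom s X X) (idˡ id) (θ⁻ ∘ᵈ θ) ≡ idᵈ)

  -- app = app₀ ∘ θ[χ(A)], stated after applying the faithful functor χ;
  -- χ(θ[χ(A)]) is characterised by its two components into the pullback
  IsoAppCompat : ∀ {Γ} {A : Ty Γ} {B : Ty (ctx A)} {Π Π₀ : Ty Γ} →
                 TyHom id Π Π₀ → TyHom id (Π ⟨ prj A ⟩) B → TyHom id (Π₀ ⟨ prj A ⟩) B → Set h
  IsoAppCompat {A = A} {Π = Π} {Π₀} θ ap ap₀ =
    ∀ (m : Hom (ctx (Π ⟨ prj A ⟩)) (ctx (Π₀ ⟨ prj A ⟩))) →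
      prj (Π₀ ⟨ prj A ⟩) ∘ m ≡ id ∘ prj (Π ⟨ prj A ⟩) →
      χ (lift Π₀ (prj A)) ∘ m ≡ χ θ ∘ χ (lift Π (prj A)) →
      χ ap ≡ χ ap₀ ∘ m

  module _ (P : PseudoStablePi) where
    open PseudoStablePi P renaming (Π to Π₀; app to app₀; lam to lam₀)

    GoodPi : ∀ {Γ} {A : Ty Γ} {B : Ty (ctx A)} (Π : Ty Γ) → TyHom id (Π ⟨ prj A ⟩) B → Set (h ⊔ u)
    GoodPi {A = A} {B} Π ap =
      Σ (TyHom id Π (Π₀ A B)) λ θ → IsVerticalIso θ × IsoAppCompat θ ap (app₀ A B)

    GoodLamPi : ∀ {Γ} {A : Ty Γ} {B : Ty (ctx A)} (Π : Ty Γ) → TyHom id (Π ⟨ prj A ⟩) B →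
                Section B → Section Π → Set (h ⊔ u)
    GoodLamPi {A = A} {B} Π ap tm l =
      Σ (TyHom id Π (Π₀ A B)) λ θ → IsVerticalIso θ × IsoAppCompat θ ap (app₀ A B) ×
        (χ θ ∘ proj₁ l ≡ proj₁ (lam₀ A B tm))

-- The chosen one is good via the identity, and a good λ-term is obtained by
-- transporting λ₀(t) along the inverse isomorphism.  For stability, a cartesian φ : Π' → Π
-- over σ and the chosen cartesian Π₀[σ_A,σ_B] : Π₀[A',B'] → Π₀[A,B] are both cartesian
-- lifts of σ, so the isomorphism θ : Π ≅ Π₀[A,B] transports to a vertical isomorphism
-- θ' : Π' ≅ Π₀[A',B'].  Compatibility of θ' with application and with λ is then checked
-- after composing with the cartesian maps σ.σ_B and Π₀[σ_A,σ_B], against which maps are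
-- determined by their components.
module Submission where

open import Defs
open import Relation.Binary.PropositionalEquality
open import Data.Product using (Σ; _×_; _,_; proj₁; proj₂)

module ComprehensionProperties {o h t u} (F : FullComprehensionCategory o h t u) where
  open FullComprehensionCategory F

  pullˡ : ∀ {W X Y Z} {a : Hom Y Z} {b : Hom X Y} {c : Hom X Z} {f : Hom W X} →
          a ∘ b ≡ c → a ∘ (b ∘ f) ≡ c ∘ f
  pullˡ {a = a} {b} {f = f} e = trans (sym (assoc a b f)) (cong (_∘ f) e)

  pullʳ : ∀ {W X Y Z} {a : Hom X Y} {b : Hom W X} {c : Hom W Y} {f : Hom Y Z} →
          a ∘ b ≡ c → (f ∘ a) ∘ b ≡ f ∘ c
  pullʳ {a = a} {b} {f = f} e = trans (assoc f a b) (cong (f ∘_) e)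

  glue-squares : ∀ {X₁ X₂ X₃ Y₁ Y₂ Y₃} {a : Hom X₃ Y₃} {b : Hom X₂ Y₂} {c : Hom X₁ Y₁}
                   {m₂ : Hom X₂ X₃} {m₁ : Hom X₁ X₂} {s₂ : Hom Y₂ Y₃} {s₁ : Hom Y₁ Y₂} →
                 a ∘ m₂ ≡ s₂ ∘ b → b ∘ m₁ ≡ s₁ ∘ c → a ∘ (m₂ ∘ m₁) ≡ (s₂ ∘ s₁) ∘ c
  glue-squares e₂ e₁ = trans (pullˡ e₂) (trans (pullʳ e₁) (sym (assoc _ _ _)))

  χ-vertical : ∀ {Γ} {X Y : Ty Γ} (k : TyHom id X Y) → prj Y ∘ χ k ≡ prj X
  χ-vertical k = trans (χ-sq k) (idˡ _)

  χ-subst : ∀ {Δ Γ} {σ σ' : Hom Δ Γ} {A : Ty Δ} {B : Ty Γ} (e : σ ≡ σ') (f : TyHom σ A B) →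
            χ (subst (λ s → TyHom s A B) e f) ≡ χ f
  χ-subst refl f = refl

  cartesian-factor : ∀ {Δ Γ Q} {σ : Hom Δ Γ} {A : Ty Δ} {B : Ty Γ} (f : TyHom σ A B) →
                     IsCartesian T f → (q₁ : Hom Q (ctx B)) (q₂ : Hom Q Δ) →
                     prj B ∘ q₁ ≡ σ ∘ q₂ →
                     Σ (Hom Q (ctx A)) λ v → (χ f ∘ v ≡ q₁) × (prj A ∘ v ≡ q₂)
  cartesian-factor f cf q₁ q₂ sq with proj₂ (χ-cart f cf) q₁ q₂ sq
  ... | v , top , bot , _ = v , top , bot

  cartesian-jointly-monic : ∀ {Δ Γ Q} {σ : Hom Δ Γ} {A : Ty Δ} {B : Ty Γ} (f : TyHom σ A B) →
                            IsCartesian T f → (w w' : Hom Q (ctx A)) →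
                            χ f ∘ w ≡ χ f ∘ w' → prj A ∘ w ≡ prj A ∘ w' → w ≡ w'
  cartesian-jointly-monic {σ = σ} {A} {B} f cf w w' top bot
    with proj₂ (χ-cart f cf) (χ f ∘ w') (prj A ∘ w') square
    where
    square : prj B ∘ (χ f ∘ w') ≡ σ ∘ (prj A ∘ w')
    square = trans (pullˡ (proj₁ (χ-cart f cf))) (assoc σ (prj A) w')
  ... | _ , _ , _ , unique = trans (unique w top bot) (sym (unique w' refl refl))

  vertical-factor : ∀ {Δ Γ} {σ : Hom Δ Γ} {X Y' : Ty Δ} {Y : Ty Γ} (ψ : TyHom σ Y' Y) →
                    IsCartesian T ψ → (q : Hom (ctx X) (ctx Y)) → prj Y ∘ q ≡ σ ∘ prj X →
                    Σ (TyHom id X Y') λ k → χ ψ ∘ χ k ≡ q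
  vertical-factor {X = X} ψ cψ q sq with cartesian-factor ψ cψ q (prj X) sq
  ... | v , top , bot with χ-full {σ = id} v (trans bot (sym (idˡ _)))
  ... | k , refl = k , top

  χ-preserves-inverse : ∀ {Γ} {X Y : Ty Γ} (f : TyHom id X Y) (g : TyHom id Y X) →
                        subst (λ s → TyHom s Y Y) (idˡ id) (f ∘ᵈ g) ≡ idᵈ → χ f ∘ χ g ≡ id
  χ-preserves-inverse f g e = begin
    χ f ∘ χ g                                      ≡⟨ sym (χ-∘ f g) ⟩
    χ (f ∘ᵈ g)                                     ≡⟨ sym (χ-subst (idˡ id) (f ∘ᵈ g)) ⟩
    χ (subst (λ s → TyHom s _ _) (idˡ id) (f ∘ᵈ g)) ≡⟨ cong χ e ⟩
    χ idᵈ                                          ≡⟨ χ-id ⟩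
    id                                             ∎
    where open ≡-Reasoning

  χ-reflects-inverse : ∀ {Γ} {X Y : Ty Γ} (f : TyHom id X Y) (g : TyHom id Y X) →
                       χ f ∘ χ g ≡ id → subst (λ s → TyHom s Y Y) (idˡ id) (f ∘ᵈ g) ≡ idᵈ
  χ-reflects-inverse f g e =
    χ-faithful _ _ (trans (χ-subst (idˡ id) (f ∘ᵈ g)) (trans (χ-∘ f g) (trans e (sym χ-id))))

  -- The map σ.σ_A.φ of the paper: a map  X ⟨ prj A' ⟩ → Y ⟨ prj A ⟩  lying over s and φ,
  -- recorded by its two components into the pullback.
  record ReindexedMap {Γ' Γ} {σ : Hom Γ' Γ} {A' : Ty Γ'} {A : Ty Γ} {X : Ty Γ'} {Y : Ty Γ}
                      (s : Hom (ctx A') (ctx A)) (φ : TyHom σ X Y) : Set h where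
    field
      map   : Hom (ctx (X ⟨ prj A' ⟩)) (ctx (Y ⟨ prj A ⟩))
      over  : prj (Y ⟨ prj A ⟩) ∘ map ≡ s ∘ prj (X ⟨ prj A' ⟩)
      lifts : χ (lift Y (prj A)) ∘ map ≡ χ φ ∘ χ (lift X (prj A'))

  reindexedMap : ∀ {Γ' Γ} {σ : Hom Γ' Γ} {A' : Ty Γ'} {A : Ty Γ} {X : Ty Γ'} {Y : Ty Γ}
                   (s : Hom (ctx A') (ctx A)) → prj A ∘ s ≡ σ ∘ prj A' → (φ : TyHom σ X Y) →
                 ReindexedMap {A' = A'} {A} s φ
  reindexedMap {σ = σ} {A'} {A} {X} {Y} s sq φ
    with cartesian-factor (lift Y (prj A)) (lift-cart Y (prj A))
           (χ φ ∘ χ (lift X (prj A'))) (s ∘ prj (X ⟨ prj A' ⟩)) square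
    where
    square : prj Y ∘ (χ φ ∘ χ (lift X (prj A'))) ≡ prj A ∘ (s ∘ prj (X ⟨ prj A' ⟩))
    square = trans (glue-squares (χ-sq φ) (χ-sq (lift X (prj A')))) (sym (pullˡ sq))
  ... | m , lifts , over = record { map = m ; over = over ; lifts = lifts }

  verticalReindexed : ∀ {Γ} {A : Ty Γ} {X Y : Ty Γ} (θ : TyHom id X Y) →
                      ReindexedMap {A' = A} {A} id θ
  verticalReindexed θ = reindexedMap id (trans (idʳ _) (sym (idˡ _))) θ

  transported-inverse : ∀ {Δ Γ} {σ : Hom Δ Γ} {X₁ X₂ : Ty Δ} {Y₁ Y₂ : Ty Γ}
                          (φ₁ : TyHom σ X₁ Y₁) (φ₂ : TyHom σ X₂ Y₂) → IsCartesian T φ₂ →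
                          {θ : TyHom id Y₁ Y₂} {θ⁻ : TyHom id Y₂ Y₁} → χ θ ∘ χ θ⁻ ≡ id →
                          {k : TyHom id X₁ X₂} {k⁻ : TyHom id X₂ X₁} →
                          χ φ₂ ∘ χ k ≡ χ θ ∘ χ φ₁ → χ φ₁ ∘ χ k⁻ ≡ χ θ⁻ ∘ χ φ₂ →
                          χ k ∘ χ k⁻ ≡ id
  transported-inverse φ₁ φ₂ cφ₂ {θ} {θ⁻} θθ⁻ {k} {k⁻} φ₂k φ₁k⁻ =
    cartesian-jointly-monic φ₂ cφ₂ _ _ top
      (trans (pullˡ (χ-vertical k)) (trans (χ-vertical k⁻) (sym (idʳ _))))
    where
    open ≡-Reasoning
    top : χ φ₂ ∘ (χ k ∘ χ k⁻) ≡ χ φ₂ ∘ id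
    top = begin
      χ φ₂ ∘ (χ k ∘ χ k⁻)   ≡⟨ pullˡ φ₂k ⟩
      (χ θ ∘ χ φ₁) ∘ χ k⁻   ≡⟨ pullʳ φ₁k⁻ ⟩
      χ θ ∘ (χ θ⁻ ∘ χ φ₂)   ≡⟨ pullˡ θθ⁻ ⟩
      id ∘ χ φ₂             ≡⟨ trans (idˡ _) (sym (idʳ _)) ⟩
      χ φ₂ ∘ id             ∎

  cartesian-iso-transport : ∀ {Δ Γ} {σ : Hom Δ Γ} {X₁ X₂ : Ty Δ} {Y₁ Y₂ : Ty Γ}
                              (φ₁ : TyHom σ X₁ Y₁) → IsCartesian T φ₁ →
                              (φ₂ : TyHom σ X₂ Y₂) → IsCartesian T φ₂ →
                              (θ : TyHom id Y₁ Y₂) → IsVerticalIso F θ →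
                              Σ (TyHom id X₁ X₂) λ θ' → IsVerticalIso F θ' × (χ φ₂ ∘ χ θ' ≡ χ θ ∘ χ φ₁)
  cartesian-iso-transport φ₁ cφ₁ φ₂ cφ₂ θ (θ⁻ , θθ⁻ , θ⁻θ)
    with vertical-factor φ₂ cφ₂ (χ θ ∘ χ φ₁) (trans (pullˡ (χ-vertical θ)) (χ-sq φ₁))
       | vertical-factor φ₁ cφ₁ (χ θ⁻ ∘ χ φ₂) (trans (pullˡ (χ-vertical θ⁻)) (χ-sq φ₂))
  ... | θ' , φ₂θ' | θ'⁻ , φ₁θ'⁻ =
    θ' , (θ'⁻ , χ-reflects-inverse θ' θ'⁻ θ'θ'⁻ , χ-reflects-inverse θ'⁻ θ' θ'⁻θ') , φ₂θ'
    where
    θ'θ'⁻ : χ θ' ∘ χ θ'⁻ ≡ id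
    θ'θ'⁻ = transported-inverse φ₁ φ₂ cφ₂ (χ-preserves-inverse θ θ⁻ θθ⁻) φ₂θ' φ₁θ'⁻
    θ'⁻θ' : χ θ'⁻ ∘ χ θ' ≡ id
    θ'⁻θ' = transported-inverse φ₂ φ₁ cφ₁ (χ-preserves-inverse θ⁻ θ θ⁻θ) φ₁θ'⁻ φ₂θ'

module GoodPiStability {o h t u} (F : FullComprehensionCategory o h t u) (P : PseudoStablePi F) where
  open FullComprehensionCategory F
  open PseudoStablePi P renaming (Π to Π₀; app to app₀; lam to lam₀; lam-eq to lam₀-eq)
  open ComprehensionProperties F
  open ReindexedMap

  isoAppCompat-refl : ∀ {Γ} {A : Ty Γ} {B : Ty (ctx A)} {Π : Ty Γ} (ap : TyHom id (Π ⟨ prj A ⟩) B) →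
                      IsoAppCompat F idᵈ ap ap
  isoAppCompat-refl {A = A} {Π = Π} ap m over lifts =
    sym (trans (cong (χ ap ∘_) m≡id) (idʳ _))
    where
    m≡id : m ≡ id
    m≡id = cartesian-jointly-monic (lift Π (prj A)) (lift-cart Π (prj A)) m id
             (trans lifts (trans (cong (_∘ _) χ-id) (trans (idˡ _) (sym (idʳ _)))))
             (trans over (trans (idˡ _) (sym (idʳ _))))

  chosen-good : ∀ {Γ} (A : Ty Γ) (B : Ty (ctx A)) → GoodPi F P (Π₀ A B) (app₀ A B)
  chosen-good A B = idᵈ , (idᵈ , idˡᵈ idᵈ , idˡᵈ idᵈ) , isoAppCompat-refl (app₀ A B)

  transported-lam : ∀ {Γ} {A : Ty Γ} {B : Ty (ctx A)} (Π : Ty Γ) (ap : TyHom id (Π ⟨ prj A ⟩) B) →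
                    GoodPi F P Π ap → (tm : Section F B) → Σ (Section F Π) λ l → GoodLamPi F P Π ap tm l
  transported-lam {A = A} {B} Π ap (θ , iso@(θ⁻ , θθ⁻ , _) , compat) tm =
    (χ θ⁻ ∘ proj₁ L , trans (pullˡ (χ-vertical θ⁻)) (proj₂ L)) ,
    θ , iso , compat , trans (pullˡ (χ-preserves-inverse θ θ⁻ θθ⁻)) (idˡ _)
    where
    L : Section F (Π₀ A B)
    L = lam₀ A B tm

  goodLam-dpEq : ∀ {Γ} {A : Ty Γ} {B : Ty (ctx A)} (Π : Ty Γ) (ap : TyHom id (Π ⟨ prj A ⟩) B)
                   (tm : Section F B) (l : Section F Π) → GoodLamPi F P Π ap tm l → DPEq F Π ap tm l
  goodLam-dpEq {A = A} {B} Π ap tm l (θ , _ , compat , θl) v sec lv = begin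
    χ ap ∘ v                   ≡⟨ cong (_∘ v) (compat (map M) (over M) (lifts M)) ⟩
    (χ (app₀ A B) ∘ map M) ∘ v ≡⟨ assoc _ _ _ ⟩
    χ (app₀ A B) ∘ (map M ∘ v) ≡⟨ lam₀-eq A B tm (map M ∘ v) sec₀ lv₀ ⟩
    proj₁ tm                   ∎
    where
    open ≡-Reasoning
    M : ReindexedMap {A' = A} {A} id θ
    M = verticalReindexed θ
    sec₀ : prj (Π₀ A B ⟨ prj A ⟩) ∘ (map M ∘ v) ≡ id
    sec₀ = trans (pullˡ (over M)) (trans (pullʳ sec) (idˡ id))
    lv₀ : χ (lift (Π₀ A B) (prj A)) ∘ (map M ∘ v) ≡ proj₁ (lam₀ A B tm) ∘ prj A
    lv₀ = trans (glue-squares (lifts M) lv) (cong (_∘ prj A) θl)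

  module Reindexing {Γ' Γ} {σ : Hom Γ' Γ} {A' : Ty Γ'} {A : Ty Γ} {B' : Ty (ctx A')} {B : Ty (ctx A)}
     (σA : TyHom σ A' A) (σB : TyHom (χ σA) B' B) (cA : IsCartesian T σA) (cB : IsCartesian T σB)
     {Π : Ty Γ} {ap : TyHom id (Π ⟨ prj A ⟩) B}
     (θ : TyHom id Π (Π₀ A B)) (iso : IsVerticalIso F θ) (compat : IsoAppCompat F θ ap (app₀ A B))
     {Π' : Ty Γ'} (φ : TyHom σ Π' Π) (cφ : IsCartesian T φ)
     {ap' : TyHom id (Π' ⟨ prj A' ⟩) B'} (ac : AppCompat F σA σB φ ap' ap) where

    ψ : TyHom σ (Π₀ A' B') (Π₀ A B)
    ψ = Πmap σA σB cA cB

    transported : Σ (TyHom id Π' (Π₀ A' B')) λ θ' → IsVerticalIso F θ' × (χ ψ ∘ χ θ' ≡ χ θ ∘ χ φ)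
    transported = cartesian-iso-transport φ cφ ψ (Πmap-cart σA σB cA cB) θ iso

    θ' : TyHom id Π' (Π₀ A' B')
    θ' = proj₁ transported

    ψθ' : χ ψ ∘ χ θ' ≡ χ θ ∘ χ φ
    ψθ' = proj₂ (proj₂ transported)

    compat' : IsoAppCompat F θ' ap' (app₀ A' B')
    compat' m over' lifts' =
      cartesian-jointly-monic σB cB _ _ top
        (trans (χ-vertical ap') (sym (trans (pullˡ (χ-vertical (app₀ A' B'))) (trans over' (idˡ _)))))
      where
      open ≡-Reasoning
      Mφ : ReindexedMap {A' = A'} {A} (χ σA) φ
      Mφ = reindexedMap (χ σA) (χ-sq σA) φ
      Mψ : ReindexedMap {A' = A'} {A} (χ σA) ψ
      Mψ = reindexedMap (χ σA) (χ-sq σA) ψ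
      Mθ : ReindexedMap {A' = A} {A} id θ
      Mθ = verticalReindexed θ
      -- both sides lie over χ σA and over χ θ ∘ χ φ = χ ψ ∘ χ θ'
      square : map Mθ ∘ map Mφ ≡ map Mψ ∘ m
      square = cartesian-jointly-monic (lift (Π₀ A B) (prj A)) (lift-cart _ _) _ _
        (trans (glue-squares (lifts Mθ) (lifts Mφ))
               (sym (trans (glue-squares (lifts Mψ) lifts') (cong (_∘ _) ψθ'))))
        (trans (glue-squares (over Mθ) (over Mφ))
               (sym (trans (glue-squares (over Mψ) over') (cong (_∘ _) (trans (idʳ _) (sym (idˡ _)))))))
      top : χ σB ∘ χ ap' ≡ χ σB ∘ (χ (app₀ A' B') ∘ m)
      top = begin
        χ σB ∘ χ ap'                       ≡⟨ ac (map Mφ) (over Mφ) (lifts Mφ) ⟩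
        χ ap ∘ map Mφ                      ≡⟨ cong (_∘ map Mφ) (compat (map Mθ) (over Mθ) (lifts Mθ)) ⟩
        (χ (app₀ A B) ∘ map Mθ) ∘ map Mφ   ≡⟨ pullʳ square ⟩
        χ (app₀ A B) ∘ (map Mψ ∘ m)        ≡⟨ sym (assoc _ _ _) ⟩
        (χ (app₀ A B) ∘ map Mψ) ∘ m        ≡⟨ cong (_∘ m) (sym (Πmap-app σA σB cA cB (map Mψ) (over Mψ) (lifts Mψ))) ⟩
        (χ σB ∘ χ (app₀ A' B')) ∘ m        ≡⟨ assoc _ _ _ ⟩
        χ σB ∘ (χ (app₀ A' B') ∘ m)        ∎

    good' : GoodPi F P Π' ap'
    good' = θ' , proj₁ (proj₂ transported) , compat'

    lam' : (tm : Section F B) (l : Section F Π) → χ θ ∘ proj₁ l ≡ proj₁ (lam₀ A B tm) →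
           (tm' : Section F B') → χ σB ∘ proj₁ tm' ≡ proj₁ tm ∘ χ σA →
           (l' : Section F Π') → χ φ ∘ proj₁ l' ≡ proj₁ l ∘ σ →
           χ θ' ∘ proj₁ l' ≡ proj₁ (lam₀ A' B' tm')
    lam' tm l θl tm' tm'σ l' l'σ =
      cartesian-jointly-monic ψ (Πmap-cart σA σB cA cB) _ _ top
        (trans (pullˡ (χ-vertical θ')) (trans (proj₂ l') (sym (proj₂ (lam₀ A' B' tm')))))
      where
      open ≡-Reasoning
      top : χ ψ ∘ (χ θ' ∘ proj₁ l') ≡ χ ψ ∘ proj₁ (lam₀ A' B' tm')
      top = begin
        χ ψ ∘ (χ θ' ∘ proj₁ l')      ≡⟨ pullˡ ψθ' ⟩
        (χ θ ∘ χ φ) ∘ proj₁ l'       ≡⟨ pullʳ l'σ ⟩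
        χ θ ∘ (proj₁ l ∘ σ)          ≡⟨ pullˡ θl ⟩
        proj₁ (lam₀ A B tm) ∘ σ      ≡⟨ sym (Πmap-lam σA σB cA cB tm tm' tm'σ) ⟩
        χ ψ ∘ proj₁ (lam₀ A' B' tm') ∎

  stableClass : IsStableClass F (GoodPi F P) (GoodLamPi F P)
  stableClass = record
    { good-nonempty = λ A B → Π₀ A B , app₀ A B , chosen-good A B
    ; lam-nonempty  = transported-lam
    ; lam-eq        = λ Π ap _ → goodLam-dpEq Π ap
    ; good-reindex  = λ σA σB cA cB _ _ (θ , iso , compat) _ φ cφ _ ac →
        Reindexing.good' σA σB cA cB θ iso compat φ cφ ac
    ; lam-reindex   = λ σA σB cA cB _ _ _ _ φ cφ _ ac tm l (θ , iso , compat , θl) tm' tm'σ l' l'σ →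
        let open Reindexing σA σB cA cB θ iso compat φ cφ ac
        in θ' , proj₁ (proj₂ transported) , compat' , lam' tm l θl tm' tm'σ l' l'σ
    }

proposition3p4p2p9 : ∀ {o h t u} (F : FullComprehensionCategory o h t u) (P : PseudoStablePi F) →
    IsStableClass F (GoodPi F P) (GoodLamPi F P)
proposition3p4p2p9 F P = GoodPiStability.stableClass F P
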